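{- In any execution of a finite parallel composition of the simplified find-or-put procedure $\mathrm{Fop}$ (described in the context) on a table $T$, with no other process accessing $T$, each invocation $\mathrm{Fop}(k)$ eventually terminates (it returns after finitely many of its own steps), and it returns one of $\mathrm{FOUND}$, $\mathrm{FULL}$, $\mathrm{PUT}$.
   Context: Let $K$ be a set of keys and fix positive integers $B_0,B_1$. A table $T=(T_0,T_1)$ consists of a primary array $T_0$ of buckets, each with $B_0$ slots $T_0[c][0..B_0-1]$, and a secondary array $T_1$ of buckets, each with $B_1$ slots $T_1[c][0..B_1-1]$. Each slot holds a distinguished value $\mathrm{EMPTY}$ or another value. Given are address functions $a_0$ (into bucket indices of $T_0$), $a_1,a_2$ (into bucket indices of $T_1$), and remainder functions $r_0,r_1,r_2$ on $K$ with values different from $\mathrm{EMPTY}$. Put $r'_0(k)=r_0(k)$, $r'_1(k)=(r_1(k),0)$, $r'_2(k)=(r_2(k),1)$, $\operatorname{sg}(0)=0$, $\operatorname{sg}(1)=\operatorname{sg}(2)=1$, and $S=\{0\}\times\{0,\dots,B_0-1\}\cup\{1,2\}\times\{0,\dots,B_1-1\}$. The total order $\prec$ on $S$: $(0,y)\prec(1+i,z)$ for all $y,z$, $i\in\{0,1\}$; $(x,y)\prec(x,z)$ iff $y<z$; $(1,y)\prec(2,z)$ iff $y<z$ (equivalently $(2,z)\prec(1,y)$ iff $z\le y$). Simplified find-or-put $\mathrm{Fop}(k)$, with local snapshot arrays $b_0,b_1,b_2$ (initially all $\mathrm{EMPTY}$): repeat forever: (1) for $x=0,1,2$ copy bucket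 $T_{\operatorname{sg}(x)}[a_x(k)]$ into $b_x$ slot by slot; (2) if $b_x[y]=r'_x(k)$ for some $(x,y)\in S$, return $\mathrm{FOUND}$; (3) else if $b_x[y]\ne\mathrm{EMPTY}$ for all $(x,y)\in S$, return $\mathrm{FULL}$; (4) else let $(x,y)$ be the $\prec$-minimum of $\{(x,y)\in S: b_x[y]=\mathrm{EMPTY}\}$ and execute $\mathrm{CAS}(T_{\operatorname{sg}(x)}[a_x(k)][y],\mathrm{EMPTY},r'_x(k))$; if it succeeds, return $\mathrm{PUT}$. Here $\mathrm{CAS}(s,\mathrm{EMPTY},v)$ atomically checks whether slot $s$ equals $\mathrm{EMPTY}$ and if so writes $v$ and returns true, otherwise returns false. Execution model: finitely many processes run $\mathrm{Fop}$ concurrently with their own local variables, sharing only $T$; executions are arbitrary interleavings of atomic steps, the only atomic operations on $T$ being single-slot reads and CAS. -}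

module Defs where

open import Data.Nat using (ℕ; zero; suc; _+_; _<_; _≤_; _<?_)
open import Data.Fin as Fin using (Fin; toℕ; fromℕ<)
open import Data.Bool using (Bool; true; false)
open import Data.Maybe using (Maybe; just; nothing)
open import Data.Product using (Σ; ∃; _×_; _,_; proj₁; proj₂)
open import Data.Sum using (_⊎_)
open import Relation.Nullary using (¬_; yes; no; does)
open import Relation.Binary.PropositionalEquality using (_≡_; _≢_)

-- Parameters of the model: keys, remainder codomains, bucket sizes B0 B1,
-- number of buckets N0 N1 of the arrays T0 T1, address and remainder functions.
record Params : Set₁ where
  field
    K  : Set
    R0 : Set
    R1 : Set
    B0 : ℕ
    B1 : ℕ
    N0 : ℕ
    N1 : ℕ
    a0 : K → Fin N0
    a1 : K → Fin N1
    a2 : K → Fin N1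
    r0 : K → R0
    r1 : K → R1
    r2 : K → R1

-- the three "virtual buckets" x ∈ {0,1,2}
data X : Set where
  x0 x1 x2 : X

data Result : Set where
  FOUND FULL PUT : Result

module Model (P : Params) where
  open Params P

  -- a slot holds EMPTY (= nothing) or a value (just v)
  -- T0 slots hold values of R0; T1 slots hold values of R1 × Bool
  -- (the tag 0 is false, the tag 1 is true)
  record Table : Set where
    constructor mkT
    field
      T0 : Fin N0 → Fin B0 → Maybe R0
      T1 : Fin N1 → Fin B1 → Maybe (R1 × Bool)
  open Table public

  size : X → ℕ
  size x0 = B0
  size x1 = B1
  size x2 = B1

  V : X → Set
  V x0 = R0
  V x1 = R1 × Bool
  V x2 = R1 × Bool

  S : Set
  S = Σ X (λ x → Fin (size x))

  r' : K → (x : X) → V x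
  r' k x0 = r0 k
  r' k x1 = (r1 k , false)
  r' k x2 = (r2 k , true)

  slot : Table → K → (s : S) → Maybe (V (proj₁ s))
  slot T k (x0 , y) = T0 T (a0 k) y
  slot T k (x1 , y) = T1 T (a1 k) y
  slot T k (x2 , y) = T1 T (a2 k) y

  writeSlot : Table → K → (s : S) → Maybe (V (proj₁ s)) → Table
  writeSlot T k (x0 , y) v = mkT t0 (T1 T)
    where
    t0 : Fin N0 → Fin B0 → Maybe R0
    t0 c y' with does (c Fin.≟ a0 k) | does (y' Fin.≟ y)
    ... | true | true = v
    ... | _    | _    = T0 T c y'
  writeSlot T k (x1 , y) v = mkT (T0 T) t1
    where
    t1 : Fin N1 → Fin B1 → Maybe (R1 × Bool)
    t1 c y' with does (c Fin.≟ a1 k) | does (y' Fin.≟ y)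
    ... | true | true = v
    ... | _    | _    = T1 T c y'
  writeSlot T k (x2 , y) v = mkT (T0 T) t1
    where
    t1 : Fin N1 → Fin B1 → Maybe (R1 × Bool)
    t1 c y' with does (c Fin.≟ a2 k) | does (y' Fin.≟ y)
    ... | true | true = v
    ... | _    | _    = T1 T c y'

  -- local snapshot arrays b_0, b_1, b_2, combined: b (x , y) = b_x[y]
  Snap : Set
  Snap = (s : S) → Maybe (V (proj₁ s))

  emptySnap : Snap
  emptySnap _ = nothing

  setSnap : Snap → (s : S) → Maybe (V (proj₁ s)) → Snap
  setSnap b (x0 , y) v (x0 , y') with does (y' Fin.≟ y)
  ... | true  = v
  ... | false = b (x0 , y')
  setSnap b (x1 , y) v (x1 , y') with does (y' Fin.≟ y)
  ... | true  = v
  ... | false = b (x1 , y')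
  setSnap b (x2 , y) v (x2 , y') with does (y' Fin.≟ y)
  ... | true  = v
  ... | false = b (x2 , y')
  setSnap b (x0 , _) v (x1 , y') = b (x1 , y')
  setSnap b (x0 , _) v (x2 , y') = b (x2 , y')
  setSnap b (x1 , _) v (x0 , y') = b (x0 , y')
  setSnap b (x1 , _) v (x2 , y') = b (x2 , y')
  setSnap b (x2 , _) v (x0 , y') = b (x0 , y')
  setSnap b (x2 , _) v (x1 , y') = b (x1 , y')

  data _≺_ : S → S → Set where
    0≺1  : ∀ {y z} → (x0 , y) ≺ (x1 , z)
    0≺2  : ∀ {y z} → (x0 , y) ≺ (x2 , z)
    same : ∀ {x} {y z : Fin (size x)} → toℕ y < toℕ z → (x , y) ≺ (x , z)
    1≺2  : ∀ {y z : Fin B1} → toℕ y < toℕ z → (x1 , y) ≺ (x2 , z)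
    2≺1  : ∀ {y z : Fin B1} → toℕ z ≤ toℕ y → (x2 , z) ≺ (x1 , y)

  IsMinEmpty : Snap → S → Set
  IsMinEmpty b s = (b s ≡ nothing) × (∀ s' → b s' ≡ nothing → s ≡ s' ⊎ s ≺ s')

  Match : K → Snap → Set
  Match k b = ∃ λ (s : S) → b s ≡ just (r' k (proj₁ s))

  AllFull : Snap → Set
  AllFull b = ∀ (s : S) → b s ≢ nothing

  -- program counter: rd s = about to read slot s in step (1)
  -- (reads go x = 0,1,2 and slot by slot); dec = steps (2)-(4); ret r = returned r
  data PC : Set where
    rd  : S → PC
    dec : PC
    ret : Result → PC

  from2 : ℕ → PC
  from2 i with i <? B1
  ... | yes p = rd (x2 , fromℕ< p)
  ... | no  _ = dec

  from1 : ℕ → PC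
  from1 i with i <? B1
  ... | yes p = rd (x1 , fromℕ< p)
  ... | no  _ = from2 0

  from0 : ℕ → PC
  from0 i with i <? B0
  ... | yes p = rd (x0 , fromℕ< p)
  ... | no  _ = from1 0

  start : PC
  start = from0 0

  next : S → PC
  next (x0 , y) = from0 (suc (toℕ y))
  next (x1 , y) = from1 (suc (toℕ y))
  next (x2 , y) = from2 (suc (toℕ y))

  record Local : Set where
    constructor mkL
    field
      pc : PC
      b  : Snap
  open Local public

  initLocal : Local
  initLocal = mkL start emptySnap

  data LStep (k : K) : Table → Local → Table → Local → Set where
    read    : ∀ {T b s} →
              LStep k T (mkL (rd s) b) T (mkL (next s) (setSnap b s (slot T k s)))
    found   : ∀ {T b} → Match k b →
              LStep k T (mkL dec b) T (mkL (ret FOUND) b)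
    full    : ∀ {T b} → ¬ Match k b → AllFull b →
              LStep k T (mkL dec b) T (mkL (ret FULL) b)
    casOk   : ∀ {T b s} → ¬ Match k b → ¬ AllFull b → IsMinEmpty b s →
              slot T k s ≡ nothing →
              LStep k T (mkL dec b) (writeSlot T k s (just (r' k (proj₁ s)))) (mkL (ret PUT) b)
    casFail : ∀ {T b s} → ¬ Match k b → ¬ AllFull b → IsMinEmpty b s →
              slot T k s ≢ nothing →
              LStep k T (mkL dec b) T (mkL start b)

  Done : Local → Set
  Done l = ∃ λ (r : Result) → pc l ≡ ret r

  record Config (n : ℕ) : Set where
    constructor mkC
    field
      table : Table
      loc   : Fin n → Local
  open Config public

  -- a scheduled step of process p (a returned process does nothing)
  data PStep {n : ℕ} (keys : Fin n → K) (p : Fin n) (c c' : Config n) : Set where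
    stutter : Done (loc c p) → c' ≡ c → PStep keys p c c'
    move    : LStep (keys p) (table c) (loc c p) (table c') (loc c' p) →
              (∀ q → q ≢ p → loc c' q ≡ loc c q) → PStep keys p c c'

  IsExecution : {n : ℕ} → (Fin n → K) → Table → (ℕ → Fin n) → (ℕ → Config n) → Set
  IsExecution keys T σ C =
    (C 0 ≡ mkC T (λ _ → initLocal)) × (∀ t → PStep keys (σ t) (C t) (C (suc t)))

ownSteps : {n : ℕ} → (ℕ → Fin n) → Fin n → ℕ → ℕ
ownSteps σ p zero = 0
ownSteps σ p (suc t) with does (σ t Fin.≟ p)
... | true  = suc (ownSteps σ p t)
... | false = ownSteps σ p t

{-# OPTIONS --safe #-}
module Submission where

open import Defs
open import Data.Bool using (true; false; if_then_else_)
open import Data.Fin as F using (Fin; toℕ)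
open import Data.Fin.Properties using (toℕ-injective; toℕ<n; toℕ-fromℕ<)
open import Data.Maybe using (Maybe; just; nothing)
open import Data.Nat using (ℕ; zero; suc; _+_; _*_; _∸_; _<_; _≤_; z≤n; s≤s; _<?_; _≟_)
open import Data.Nat.Properties
open import Data.Product using (∃; _×_; _,_; proj₁; proj₂)
open import Data.Sum using (_⊎_; inj₁; inj₂)
open import Data.Vec.Functional using (Vector)
open import Function using (_∘_)
open import Relation.Binary.Definitions using (tri<; tri≈; tri>)
open import Relation.Binary.PropositionalEquality using (_≡_; _≢_; refl; sym; cong)
open import Relation.Nullary using (¬_; yes; no; does; contradiction)
open import Relation.Nullary.Decidable using (dec-true; dec-false)
open import Algebra.Properties.Monoid.Sum +-0-monoid using (sum)

-- A process running Fop(k) sees, in the current iteration, its snapshot at the slots it has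
-- already read and the table at the others; measure it by the number of empty slots in this
-- view and by how far it is into the iteration.  Slots are only ever filled, so the snapshot
-- never shows a slot filled that is empty in the table.  Hence reads advance the iteration
-- without adding empty slots to the view, steps of other processes only remove empty slots,
-- and a failed CAS targets a slot empty in the snapshot but filled in the table, so that
-- restarting the iteration strictly lowers the number of empty slots in the view.  A suitably
-- weighted potential therefore drops with every own step and never rises with other steps.

sum-mono-≤ : ∀ {n} {f g : Vector ℕ n} → (∀ i → f i ≤ g i) → sum f ≤ sum g
sum-mono-≤ {zero}  f≤g = z≤n
sum-mono-≤ {suc n} f≤g = +-mono-≤ (f≤g F.zero) (sum-mono-≤ (f≤g ∘ F.suc))

sum-mono-< : ∀ {n} {f g : Vector ℕ n} → (∀ i → f i ≤ g i) → ∀ j → f j < g j → sum f < sum g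
sum-mono-< f≤g F.zero    fj<gj = +-mono-<-≤ fj<gj (sum-mono-≤ (f≤g ∘ F.suc))
sum-mono-< f≤g (F.suc j) fj<gj = +-mono-≤-< (f≤g F.zero) (sum-mono-< (f≤g ∘ F.suc) j fj<gj)

vacancy : {A : Set} → Maybe A → ℕ
vacancy nothing  = 1
vacancy (just _) = 0

vacancy≤1 : {A : Set} (m : Maybe A) → vacancy m ≤ 1
vacancy≤1 nothing  = ≤-refl
vacancy≤1 (just _) = z≤n

vacancy-occupied : {A : Set} {m : Maybe A} → m ≢ nothing → vacancy m ≡ 0
vacancy-occupied {m = nothing} m≢nothing = contradiction refl m≢nothing
vacancy-occupied {m = just _}  _         = refl

∑X : (X → ℕ) → ℕ
∑X h = h x0 + h x1 + h x2

∑X-mono-≤ : ∀ {g h} → (∀ x → g x ≤ h x) → ∑X g ≤ ∑X h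
∑X-mono-≤ g≤h = +-mono-≤ (+-mono-≤ (g≤h x0) (g≤h x1)) (g≤h x2)

∑X-mono-< : ∀ {g h} → (∀ x → g x ≤ h x) → ∀ x → g x < h x → ∑X g < ∑X h
∑X-mono-< g≤h x0 lt = +-mono-<-≤ (+-mono-<-≤ lt (g≤h x1)) (g≤h x2)
∑X-mono-< g≤h x1 lt = +-mono-<-≤ (+-mono-≤-< (g≤h x0) lt) (g≤h x2)
∑X-mono-< g≤h x2 lt = +-mono-≤-< (+-mono-≤ (g≤h x0) (g≤h x1)) lt

module Progress (P : Params) where
  open Params P
  open Model P

  ∑S : (S → ℕ) → ℕ
  ∑S g = ∑X (λ x → sum (λ y → g (x , y)))

  ∑S-mono-≤ : ∀ {g h} → (∀ s → g s ≤ h s) → ∑S g ≤ ∑S h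
  ∑S-mono-≤ g≤h = ∑X-mono-≤ (λ x → sum-mono-≤ (λ y → g≤h (x , y)))

  ∑S-mono-< : ∀ {g h} → (∀ s → g s ≤ h s) → ∀ s → g s < h s → ∑S g < ∑S h
  ∑S-mono-< g≤h (x , y) lt =
    ∑X-mono-< (λ x' → sum-mono-≤ (λ y' → g≤h (x' , y'))) x (sum-mono-< (λ y' → g≤h (x , y')) y lt)

  #S : ℕ
  #S = B0 + B1 + B1

  offset : X → ℕ
  offset x0 = 0
  offset x1 = B0
  offset x2 = B0 + B1

  -- Position of a slot in the order in which step (1) reads S.
  index : S → ℕ
  index (x , y) = offset x + toℕ y

  index<#S : ∀ s → index s < #S
  index<#S (x0 , y) = <-≤-trans (toℕ<n y) (≤-trans (m≤m+n B0 B1) (m≤m+n (B0 + B1) B1))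
  index<#S (x1 , y) = <-≤-trans (+-monoʳ-< B0 (toℕ<n y)) (m≤m+n (B0 + B1) B1)
  index<#S (x2 , y) = +-monoʳ-< (B0 + B1) (toℕ<n y)

  index-x0<x1 : ∀ y y' → index (x0 , y) < index (x1 , y')
  index-x0<x1 y y' = <-≤-trans (toℕ<n y) (m≤m+n B0 (toℕ y'))

  index-x0<x2 : ∀ y y' → index (x0 , y) < index (x2 , y')
  index-x0<x2 y y' = <-≤-trans (toℕ<n y) (≤-trans (m≤m+n B0 B1) (m≤m+n (B0 + B1) (toℕ y')))

  index-x1<x2 : ∀ y y' → index (x1 , y) < index (x2 , y')
  index-x1<x2 y y' = <-≤-trans (+-monoʳ-< B0 (toℕ<n y)) (m≤m+n (B0 + B1) (toℕ y'))

  index-injective : ∀ {s s'} → index s ≡ index s' → s ≡ s'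
  index-injective {x0 , y} {x0 , y'} e = cong (x0 ,_) (toℕ-injective e)
  index-injective {x1 , y} {x1 , y'} e = cong (x1 ,_) (toℕ-injective (+-cancelˡ-≡ B0 _ _ e))
  index-injective {x2 , y} {x2 , y'} e = cong (x2 ,_) (toℕ-injective (+-cancelˡ-≡ (B0 + B1) _ _ e))
  index-injective {x0 , y} {x1 , y'} e = contradiction e (<⇒≢ (index-x0<x1 y y'))
  index-injective {x0 , y} {x2 , y'} e = contradiction e (<⇒≢ (index-x0<x2 y y'))
  index-injective {x1 , y} {x2 , y'} e = contradiction e (<⇒≢ (index-x1<x2 y y'))
  index-injective {x1 , y} {x0 , y'} e = contradiction e (>⇒≢ (index-x0<x1 y' y))
  index-injective {x2 , y} {x0 , y'} e = contradiction e (>⇒≢ (index-x0<x2 y' y))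
  index-injective {x2 , y} {x1 , y'} e = contradiction e (>⇒≢ (index-x1<x2 y' y))

  -- The number of slots already read in the current iteration; its value at ret is junk.
  pcIndex : PC → ℕ
  pcIndex (rd s)  = index s
  pcIndex dec     = #S
  pcIndex (ret _) = 0

  pcIndex-from2 : ∀ i → i ≤ B1 → pcIndex (from2 i) ≡ offset x2 + i
  pcIndex-from2 i i≤B1 with i <? B1
  ... | yes i<B1 = cong (offset x2 +_) (toℕ-fromℕ< i<B1)
  ... | no  i≮B1 = cong (offset x2 +_) (sym (≤∧≮⇒≡ i≤B1 i≮B1))

  pcIndex-from1 : ∀ i → i ≤ B1 → pcIndex (from1 i) ≡ offset x1 + i
  pcIndex-from1 i i≤B1 with i <? B1
  ... | yes i<B1 = cong (offset x1 +_) (toℕ-fromℕ< i<B1)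
  ... | no  i≮B1 rewrite pcIndex-from2 0 z≤n | +-identityʳ (B0 + B1) | ≤∧≮⇒≡ i≤B1 i≮B1 = refl

  pcIndex-from0 : ∀ i → i ≤ B0 → pcIndex (from0 i) ≡ i
  pcIndex-from0 i i≤B0 with i <? B0
  ... | yes i<B0 = toℕ-fromℕ< i<B0
  ... | no  i≮B0 rewrite pcIndex-from1 0 z≤n | +-identityʳ B0 = sym (≤∧≮⇒≡ i≤B0 i≮B0)

  pcIndex-next : ∀ s → pcIndex (next s) ≡ suc (index s)
  pcIndex-next (x0 , y) = pcIndex-from0 (suc (toℕ y)) (toℕ<n y)
  pcIndex-next (x1 , y) rewrite pcIndex-from1 (suc (toℕ y)) (toℕ<n y) = +-suc B0 (toℕ y)
  pcIndex-next (x2 , y) rewrite pcIndex-from2 (suc (toℕ y)) (toℕ<n y) = +-suc (B0 + B1) (toℕ y)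

  pcIndex-start : pcIndex start ≡ 0
  pcIndex-start = pcIndex-from0 0 z≤n

  setSnap-same : ∀ b s v → setSnap b s v s ≡ v
  setSnap-same b (x0 , y) v with y F.≟ y
  ... | yes _   = refl
  ... | no  y≢y = contradiction refl y≢y
  setSnap-same b (x1 , y) v with y F.≟ y
  ... | yes _   = refl
  ... | no  y≢y = contradiction refl y≢y
  setSnap-same b (x2 , y) v with y F.≟ y
  ... | yes _   = refl
  ... | no  y≢y = contradiction refl y≢y

  setSnap-other : ∀ b s v s' → s' ≢ s → setSnap b s v s' ≡ b s'
  setSnap-other b (x0 , y) v (x0 , y') s'≢s with y' F.≟ y
  ... | yes refl = contradiction refl s'≢s
  ... | no  _    = refl
  setSnap-other b (x1 , y) v (x1 , y') s'≢s with y' F.≟ y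
  ... | yes refl = contradiction refl s'≢s
  ... | no  _    = refl
  setSnap-other b (x2 , y) v (x2 , y') s'≢s with y' F.≟ y
  ... | yes refl = contradiction refl s'≢s
  ... | no  _    = refl
  setSnap-other b (x0 , y) v (x1 , y') _ = refl
  setSnap-other b (x0 , y) v (x2 , y') _ = refl
  setSnap-other b (x1 , y) v (x0 , y') _ = refl
  setSnap-other b (x1 , y) v (x2 , y') _ = refl
  setSnap-other b (x2 , y) v (x0 , y') _ = refl
  setSnap-other b (x2 , y) v (x1 , y') _ = refl

  _⊑_ : Table → Table → Set
  T ⊑ T' = (∀ c y → vacancy (T0 T' c y) ≤ vacancy (T0 T c y))
         × (∀ c y → vacancy (T1 T' c y) ≤ vacancy (T1 T c y))

  ⊑-refl : ∀ T → T ⊑ T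
  ⊑-refl T = (λ _ _ → ≤-refl) , (λ _ _ → ≤-refl)

  slot-⊑ : ∀ {T T'} → T ⊑ T' → ∀ k s → vacancy (slot T' k s) ≤ vacancy (slot T k s)
  slot-⊑ T⊑T' k (x0 , y) = proj₁ T⊑T' (a0 k) y
  slot-⊑ T⊑T' k (x1 , y) = proj₂ T⊑T' (a1 k) y
  slot-⊑ T⊑T' k (x2 , y) = proj₂ T⊑T' (a2 k) y

  writeSlot-⊒ : ∀ T k s v → T ⊑ writeSlot T k s (just v)
  writeSlot-⊒ T k (x0 , y) v = fill , (λ _ _ → ≤-refl)
    where
    fill : ∀ c y' → vacancy (T0 (writeSlot T k (x0 , y) (just v)) c y') ≤ vacancy (T0 T c y')
    fill c y' with c F.≟ a0 k | y' F.≟ y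
    ... | yes _ | yes _ = z≤n
    ... | yes _ | no  _ = ≤-refl
    ... | no  _ | _     = ≤-refl
  writeSlot-⊒ T k (x1 , y) v = (λ _ _ → ≤-refl) , fill
    where
    fill : ∀ c y' → vacancy (T1 (writeSlot T k (x1 , y) (just v)) c y') ≤ vacancy (T1 T c y')
    fill c y' with c F.≟ a1 k | y' F.≟ y
    ... | yes _ | yes _ = z≤n
    ... | yes _ | no  _ = ≤-refl
    ... | no  _ | _     = ≤-refl
  writeSlot-⊒ T k (x2 , y) v = (λ _ _ → ≤-refl) , fill
    where
    fill : ∀ c y' → vacancy (T1 (writeSlot T k (x2 , y) (just v)) c y') ≤ vacancy (T1 T c y')
    fill c y' with c F.≟ a2 k | y' F.≟ y
    ... | yes _ | yes _ = z≤n
    ... | yes _ | no  _ = ≤-refl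
    ... | no  _ | _     = ≤-refl

  LStep-⊑ : ∀ {k T l T' l'} → LStep k T l T' l' → T ⊑ T'
  LStep-⊑ {T = T} read                    = ⊑-refl T
  LStep-⊑ {T = T} (found _)               = ⊑-refl T
  LStep-⊑ {T = T} (full _ _)              = ⊑-refl T
  LStep-⊑ {k} {T} (casOk {s = s} _ _ _ _) = writeSlot-⊒ T k s _
  LStep-⊑ {T = T} (casFail _ _ _ _)       = ⊑-refl T

  Done-stuck : ∀ {k T l T' l'} → Done l → ¬ LStep k T l T' l'
  Done-stuck (_ , ()) read
  Done-stuck (_ , ()) (found _)
  Done-stuck (_ , ()) (full _ _)
  Done-stuck (_ , ()) (casOk _ _ _ _)
  Done-stuck (_ , ()) (casFail _ _ _ _)

  module Potential (k : K) where

    Outdated : Snap → Table → Set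
    Outdated b T = ∀ s → vacancy (slot T k s) ≤ vacancy (b s)

    view : Table → Snap → ℕ → S → ℕ
    view T b i s = if does (index s <? i) then vacancy (b s) else vacancy (slot T k s)

    vacancies : Table → Snap → ℕ → ℕ
    vacancies T b i = ∑S (view T b i)

    -- Each unit of vacancies outweighs any progress within an iteration.
    potential : Table → Local → ℕ
    potential T l = (suc #S ∸ pcIndex (pc l)) + vacancies T (b l) (pcIndex (pc l)) * suc #S

    emptySnap-outdated : ∀ T → Outdated emptySnap T
    emptySnap-outdated T s = vacancy≤1 (slot T k s)

    Outdated-⊑ : ∀ {b T T'} → T ⊑ T' → Outdated b T → Outdated b T'
    Outdated-⊑ T⊑T' outdated s = ≤-trans (slot-⊑ T⊑T' k s) (outdated s)

    Outdated-read : ∀ {b T} s → Outdated b T → Outdated (setSnap b s (slot T k s)) T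
    Outdated-read {b} {T} s outdated s' with index s' ≟ index s
    ... | no  ne rewrite setSnap-other b s (slot T k s) s' (ne ∘ cong index) = outdated s'
    ... | yes eq with index-injective {s'} {s} eq
    ...   | refl rewrite setSnap-same b s (slot T k s) = ≤-refl

    view-read : ∀ T b s s' →
                view T (setSnap b s (slot T k s)) (suc (index s)) s' ≡ view T b (index s) s'
    view-read T b s s' with <-cmp (index s') (index s)
    ... | tri< lt _ _
      rewrite dec-true (index s' <? suc (index s)) (m<n⇒m<1+n lt)
            | dec-true (index s' <? index s) lt
            | setSnap-other b s (slot T k s) s' (<⇒≢ lt ∘ cong index) = refl
    ... | tri> _ _ gt
      rewrite dec-false (index s' <? suc (index s)) (<⇒≱ gt ∘ m<1+n⇒m≤n)
            | dec-false (index s' <? index s) (<⇒≯ gt) = refl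
    ... | tri≈ _ eq _ with index-injective {s'} {s} eq
    ...   | refl
      rewrite dec-true (index s <? suc (index s)) (n<1+n (index s))
            | dec-false (index s <? index s) (n≮n (index s)) =
      cong vacancy (setSnap-same b s (slot T k s))

    view-all-read : ∀ T b s → view T b #S s ≡ vacancy (b s)
    view-all-read T b s rewrite dec-true (index s <? #S) (index<#S s) = refl

    view-⊑ : ∀ {T T'} → T ⊑ T' → ∀ b i s → view T' b i s ≤ view T b i s
    view-⊑ T⊑T' b i s with does (index s <? i)
    ... | true  = ≤-refl
    ... | false = slot-⊑ T⊑T' k s

    potential-⊑ : ∀ {T T'} → T ⊑ T' → ∀ l → potential T' l ≤ potential T l
    potential-⊑ T⊑T' l =
      +-monoʳ-≤ (suc #S ∸ pcIndex (pc l))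
        (*-monoˡ-≤ (suc #S) (∑S-mono-≤ (view-⊑ T⊑T' (b l) (pcIndex (pc l)))))

    read-decreases : ∀ T b s →
                     potential T (mkL (next s) (setSnap b s (slot T k s))) < potential T (mkL (rd s) b)
    read-decreases T b s rewrite pcIndex-next s =
      +-mono-<-≤ (∸-monoʳ-< (n<1+n (index s)) (m≤n⇒m≤1+n (index<#S s)))
                 (*-monoˡ-≤ (suc #S) (∑S-mono-≤ (≤-reflexive ∘ view-read T b s)))

    -- The failed CAS witnesses a slot that the table has filled since the snapshot was taken.
    restart-decreases : ∀ T b s → Outdated b T → b s ≡ nothing → slot T k s ≢ nothing →
                        potential T (mkL start b) < potential T (mkL dec b)
    restart-decreases T b s outdated b-empty T-filled rewrite pcIndex-start | m+n∸n≡m 1 #S =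
      s≤s (*-monoˡ-≤ (suc #S) (∑S-mono-< none≤all s none<all))
      where
      none≤all : ∀ s' → view T b 0 s' ≤ view T b #S s'
      none≤all s' rewrite view-all-read T b s' = outdated s'
      none<all : view T b 0 s < view T b #S s
      none<all rewrite view-all-read T b s | b-empty | vacancy-occupied T-filled = ≤-refl

    own-step : ∀ {T l T' l'} → LStep k T l T' l' → Outdated (b l) T →
               Done l' ⊎ (Outdated (b l') T' × potential T' l' < potential T l)
    own-step {T} (read {b = b} {s = s}) outdated =
      inj₂ (Outdated-read s outdated , read-decreases T b s)
    own-step (found _)       _ = inj₁ (FOUND , refl)
    own-step (full _ _)      _ = inj₁ (FULL , refl)
    own-step (casOk _ _ _ _) _ = inj₁ (PUT , refl)
    own-step {T} (casFail {b = b} {s = s} _ _ (b-empty , _) T-filled) outdated =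
      inj₂ (outdated , restart-decreases T b s outdated b-empty T-filled)

  module Execution {n : ℕ} (keys : Fin n → K) (T : Table) (p : Fin n) where
    open Potential (keys p)

    Invariant : Table → Local → ℕ → Set
    Invariant T' l steps =
      Done l ⊎ (Outdated (b l) T' × potential T' l + steps ≤ potential T initLocal)

    invariant-own : ∀ {c c' steps} → PStep keys p c c' →
                    Invariant (table c) (loc c p) steps → Invariant (table c') (loc c' p) (suc steps)
    invariant-own (stutter done refl) _ = inj₁ done
    invariant-own (move step _) (inj₁ done) = contradiction step (Done-stuck done)
    invariant-own {steps = steps} (move step _) (inj₂ (outdated , bounded))
      with own-step step outdated
    ... | inj₁ done = inj₁ done
    ... | inj₂ (outdated' , decreased) =
      inj₂ (outdated' , ≤-trans (≤-reflexive (+-suc _ steps)) (≤-trans (+-monoˡ-≤ steps decreased) bounded))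

    invariant-⊑ : ∀ {T₁ T₂ l steps} → T₁ ⊑ T₂ → Invariant T₁ l steps → Invariant T₂ l steps
    invariant-⊑ _ (inj₁ done) = inj₁ done
    invariant-⊑ {l = l} {steps} T₁⊑T₂ (inj₂ (outdated , bounded)) =
      inj₂ (Outdated-⊑ T₁⊑T₂ outdated , ≤-trans (+-monoˡ-≤ steps (potential-⊑ T₁⊑T₂ l)) bounded)

    invariant-other : ∀ {q c c' steps} → q ≢ p → PStep keys q c c' →
                      Invariant (table c) (loc c p) steps → Invariant (table c') (loc c' p) steps
    invariant-other q≢p (stutter _ refl) inv = inv
    invariant-other q≢p (move step others) inv
      rewrite others p (q≢p ∘ sym) = invariant-⊑ (LStep-⊑ step) inv

    invariant : ∀ {σ C} → IsExecution keys T σ C →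
                ∀ t → Invariant (table (C t)) (loc (C t) p) (ownSteps σ p t)
    invariant (init , _) zero rewrite init =
      inj₂ (emptySnap-outdated T , ≤-reflexive (+-identityʳ (potential T initLocal)))
    invariant {σ} ex@(_ , steps) (suc t) with σ t F.≟ p
    ... | yes refl = invariant-own (steps t) (invariant ex t)
    ... | no  σt≢p = invariant-other σt≢p (steps t) (invariant ex t)

    terminates : ∀ {σ C} → IsExecution keys T σ C →
                 ∃ λ (m : ℕ) → ∀ (t : ℕ) → m ≤ ownSteps σ p t → Done (loc (C t) p)
    terminates {σ} {C} ex = suc (potential T initLocal) , done
      where
      done : ∀ t → suc (potential T initLocal) ≤ ownSteps σ p t → Done (loc (C t) p)
      done t many-steps with invariant ex t
      ... | inj₁ returned = returned
      ... | inj₂ (_ , bounded) = contradiction (≤-trans many-steps (≤-trans (m≤n+m _ _) bounded)) (n≮n _)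

-- The bucket sizes need not be positive.
lemma4 : (P : Params) → 0 < Params.B0 P → 0 < Params.B1 P →
         (n : ℕ) (keys : Fin n → Params.K P) (T : Model.Table P)
         (σ : ℕ → Fin n) (C : ℕ → Model.Config P n) →
         Model.IsExecution P keys T σ C →
         (p : Fin n) →
         ∃ λ (m : ℕ) → ∀ (t : ℕ) → m ≤ ownSteps σ p t →
           ∃ λ (r : Result) → Model.pc (Model.loc (C t) p) ≡ Model.ret r
lemma4 P _ _ n keys T σ C ex p = Progress.Execution.terminates P keys T p ex
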